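{- Let $t\geq s>n\geq 2$ be integers and let $G$ be the complete bipartite graph with parts $X$ and $Y$ of sizes $t$ and $s$ respectively. If $s-\lfloor \frac{sn}{t}\rfloor\leq n$, then there is a coloring of the edges of $G$ with colors $\{1,2\}$ such that (i) $d_1(v)\leq n$ for all $v\in X$, and (ii) $d_2(v)\leq n$ for all $v\in Y$.
   Context: $d_i(v)$ denotes the number of edges of color $i$ incident to the vertex $v$. -}

module Defs where

open import Data.Nat using (ℕ; zero; suc)
open import Data.Fin using (Fin; zero; suc)
open import Data.Bool using (Bool; true; false)
open import Relation.Nullary using (Dec; yes; no)
open import Data.Fin using (_≟_)

Colour : Set
Colour = Fin 2

colour1 colour2 : Colour
colour1 = zero
colour2 = suc zero

count : {m : ℕ} → (Fin m → Colour) → Colour → ℕ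
count {zero} f c = 0
count {suc m} f c with f zero ≟ c
... | yes _ = suc (count (λ j → f (suc j)) c)
... | no _ = count (λ j → f (suc j)) c

-- An edge colouring of the complete bipartite graph K_{X,Y} with X = Fin t, Y = Fin s:
-- every pair (x , y) is an edge, coloured by col x y.
EdgeColouring : ℕ → ℕ → Set
EdgeColouring t s = Fin t → Fin s → Colour

degX : {t s : ℕ} → EdgeColouring t s → Colour → Fin t → ℕ
degX col i x = count (λ y → col x y) i

degY : {t s : ℕ} → EdgeColouring t s → Colour → Fin s → ℕ
degY col i y = count (λ x → col x y) i

-- Put a = s − n and level x y = ⌊(x a + y n) / s⌋. Since a ≤ s, moving from (x , y) to
-- (x + 1 , y) raises the level by 0 or 1; colour the edge xy with colour 2 exactly when it
-- rises. Since a + n = s, level (x + 1) (y + 1) = level x y + 1, so xy has colour 1 exactly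
-- when the level rises from (x + 1 , y) to (x + 1 , y + 1). Both degrees therefore telescope:
-- d₁(x) = level (x + 1) s − level (x + 1) 0 = n, and d₂(y) = level t y − level 0 y ≤ n
-- whenever t a ≤ n s, which is what s − ⌊s n / t⌋ ≤ n amounts to.
module Submission where

open import Defs
open import Data.Nat using (ℕ; zero; suc; _+_; _*_; _∸_; _/_; _≤_; _<_; z<s; NonZero; >-nonZero)
open import Data.Nat.Properties
  using (+-comm; +-identityʳ; *-comm; *-monoʳ-≤; +-monoˡ-≤; +-monoʳ-≤; m≤m+n; m≤n+m; ≤-antisym; ≤-trans;
         ≤-reflexive; <⇒≤; m<1+n⇒m≤n; m≤n⇒m<n∨m≡n; m+n∸n≡m; m∸n+n≡m; m≤n+m∸n; m≤n+o⇒m∸n≤o;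
         +-cancelʳ-≡; +-cancelʳ-≤; <-≤-trans; +-suc; module ≤-Reasoning)
  renaming (_≟_ to _≟ℕ_)
open import Data.Nat.DivMod
  using (+-distrib-/-∣ʳ; m*n/n≡m; m/n≡1+[m∸n]/n; /-congˡ; /-monoˡ-≤; m/n*n≤m)
open import Data.Nat.Divisibility using (divides-refl)
open import Data.Nat.Tactic.RingSolver using (solve-∀)
open import Data.Fin using (Fin; toℕ; zero; suc; _≟_)
open import Data.Product using (Σ; _×_; _,_)
open import Data.Sum using (_⊎_; inj₁; inj₂)
open import Data.Empty using (⊥-elim)
open import Relation.Nullary using (yes; no)
open import Relation.Binary.PropositionalEquality
  using (_≡_; _≢_; refl; sym; trans; cong; module ≡-Reasoning)

≢colour1⇒≡colour2 : {c : Colour} → c ≢ colour1 → c ≡ colour2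
≢colour1⇒≡colour2 {zero}     c≢1 = ⊥-elim (c≢1 refl)
≢colour1⇒≡colour2 {suc zero} _   = refl

≢colour2⇒≡colour1 : {c : Colour} → c ≢ colour2 → c ≡ colour1
≢colour2⇒≡colour1 {zero}     _   = refl
≢colour2⇒≡colour1 {suc zero} c≢2 = ⊥-elim (c≢2 refl)

count-telescope : ∀ {m} (f : Fin m → Colour) (c : Colour) (g : ℕ → ℕ) →
  (∀ j → f j ≡ c → g (suc (toℕ j)) ≡ suc (g (toℕ j))) →
  (∀ j → f j ≢ c → g (suc (toℕ j)) ≡ g (toℕ j)) →
  count f c + g 0 ≡ g m
count-telescope {zero}  f c g rise stay = refl
count-telescope {suc m} f c g rise stay =
  trans first-step (count-telescope f′ c (λ i → g (suc i)) (λ j → rise (suc j)) (λ j → stay (suc j)))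
  where
  f′ : Fin m → Colour
  f′ j = f (suc j)
  first-step : count f c + g 0 ≡ count f′ c + g 1
  first-step with f zero ≟ c
  ... | yes f0≡c = trans (sym (+-suc (count f′ c) (g 0))) (cong (count f′ c +_) (sym (rise zero f0≡c)))
  ... | no f0≢c  = cong (count f′ c +_) (sym (stay zero f0≢c))

[m+kn]/n≡m/n+k : ∀ m k n .{{_ : NonZero n}} → (m + k * n) / n ≡ m / n + k
[m+kn]/n≡m/n+k m k n = trans (+-distrib-/-∣ʳ m (divides-refl k)) (cong (m / n +_) (m*n/n≡m k n))

[m+n]/n≡1+m/n : ∀ m n .{{_ : NonZero n}} → (m + n) / n ≡ suc (m / n)
[m+n]/n≡1+m/n m n = trans (m/n≡1+[m∸n]/n (m≤n+m n m)) (cong suc (/-congˡ (m+n∸n≡m m n)))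

[m+o]/n≡m/n⊎1+m/n : ∀ m {n o} .{{_ : NonZero n}} → o ≤ n →
  (m + o) / n ≡ m / n ⊎ (m + o) / n ≡ suc (m / n)
[m+o]/n≡m/n⊎1+m/n m {n} {o} o≤n with m≤n⇒m<n∨m≡n at-most-one-more
  where
  at-most-one-more : (m + o) / n ≤ suc (m / n)
  at-most-one-more = ≤-trans (/-monoˡ-≤ n (+-monoʳ-≤ m o≤n)) (≤-reflexive ([m+n]/n≡1+m/n m n))
... | inj₁ below = inj₁ (≤-antisym (m<1+n⇒m≤n below) (/-monoˡ-≤ n (m≤m+n m o)))
... | inj₂ equal = inj₂ equal

[1+x]a+yn≡xa+yn+a : ∀ x y a n → suc x * a + y * n ≡ x * a + y * n + a
[1+x]a+yn≡xa+yn+a = solve-∀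

[1+x]a+[1+y]n≡xa+yn+[a+n] : ∀ x y a n → suc x * a + suc y * n ≡ x * a + y * n + (a + n)
[1+x]a+[1+y]n≡xa+yn+[a+n] = solve-∀

module Staircase (a n s : ℕ) .{{_ : NonZero s}} (a+n≡s : a + n ≡ s) where

  level : ℕ → ℕ → ℕ
  level x y = (x * a + y * n) / s

  a≤s : a ≤ s
  a≤s = ≤-trans (m≤m+n a n) (≤-reflexive a+n≡s)

  level-step : ∀ x y → level (suc x) y ≡ level x y ⊎ level (suc x) y ≡ suc (level x y)
  level-step x y rewrite [1+x]a+yn≡xa+yn+a x y a n = [m+o]/n≡m/n⊎1+m/n (x * a + y * n) a≤s

  level-diagonal : ∀ x y → level (suc x) (suc y) ≡ suc (level x y)
  level-diagonal x y = begin
    (suc x * a + suc y * n) / s   ≡⟨ /-congˡ ([1+x]a+[1+y]n≡xa+yn+[a+n] x y a n) ⟩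
    (x * a + y * n + (a + n)) / s ≡⟨ /-congˡ (cong (x * a + y * n +_) a+n≡s) ⟩
    (x * a + y * n + s) / s       ≡⟨ [m+n]/n≡1+m/n (x * a + y * n) s ⟩
    suc (level x y)               ∎
    where
    open ≡-Reasoning

  level-across-row : ∀ x → level x s ≡ level x 0 + n
  level-across-row x = begin
    (x * a + s * n) / s ≡⟨ /-congˡ (cong (x * a +_) (*-comm s n)) ⟩
    (x * a + n * s) / s ≡⟨ [m+kn]/n≡m/n+k (x * a) n s ⟩
    (x * a) / s + n     ≡⟨ cong (λ m → m / s + n) (sym (+-identityʳ (x * a))) ⟩
    level x 0 + n       ∎
    where open ≡-Reasoning

  level-down-column : ∀ t → t * a ≤ n * s → ∀ y → level t y ≤ level 0 y + n
  level-down-column t ta≤ns y = begin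
    (t * a + y * n) / s ≤⟨ /-monoˡ-≤ s (+-monoˡ-≤ (y * n) ta≤ns) ⟩
    (n * s + y * n) / s ≡⟨ /-congˡ (+-comm (n * s) (y * n)) ⟩
    (y * n + n * s) / s ≡⟨ [m+kn]/n≡m/n+k (y * n) n s ⟩
    (y * n) / s + n     ∎
    where open ≤-Reasoning

  stair : ℕ → ℕ → Colour
  stair x y with level (suc x) y ≟ℕ suc (level x y)
  ... | yes _ = colour2
  ... | no _  = colour1

  stair-colour2 : ∀ x y → stair x y ≡ colour2 → level (suc x) y ≡ suc (level x y)
  stair-colour2 x y with level (suc x) y ≟ℕ suc (level x y)
  ... | yes rises = λ _ → rises
  ... | no _      = λ ()

  stair-colour1 : ∀ x y → stair x y ≡ colour1 → level (suc x) y ≡ level x y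
  stair-colour1 x y with level (suc x) y ≟ℕ suc (level x y) | level-step x y
  ... | yes _     | _          = λ ()
  ... | no _      | inj₁ stays = λ _ → stays
  ... | no ¬rises | inj₂ rises = ⊥-elim (¬rises rises)

  stair-row-count : ∀ x → count (λ (y : Fin s) → stair x (toℕ y)) colour1 ≡ n
  stair-row-count x = +-cancelʳ-≡ (level (suc x) 0) _ n (begin
    count row colour1 + level (suc x) 0 ≡⟨ count-telescope row colour1 (level (suc x)) rise stay ⟩
    level (suc x) s                     ≡⟨ level-across-row (suc x) ⟩
    level (suc x) 0 + n                 ≡⟨ +-comm (level (suc x) 0) n ⟩
    n + level (suc x) 0                 ∎)
    where
    open ≡-Reasoning
    row : Fin s → Colour
    row y = stair x (toℕ y)
    rise : ∀ y → row y ≡ colour1 → level (suc x) (suc (toℕ y)) ≡ suc (level (suc x) (toℕ y))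
    rise y is1 = trans (level-diagonal x (toℕ y)) (cong suc (sym (stair-colour1 x (toℕ y) is1)))
    stay : ∀ y → row y ≢ colour1 → level (suc x) (suc (toℕ y)) ≡ level (suc x) (toℕ y)
    stay y ≢1 = trans (level-diagonal x (toℕ y)) (sym (stair-colour2 x (toℕ y) (≢colour1⇒≡colour2 ≢1)))

  stair-column-count : ∀ t → t * a ≤ n * s → ∀ y → count (λ (x : Fin t) → stair (toℕ x) y) colour2 ≤ n
  stair-column-count t ta≤ns y = +-cancelʳ-≤ (level 0 y) _ n (begin
    count column colour2 + level 0 y ≡⟨ count-telescope column colour2 (λ x → level x y) rise stay ⟩
    level t y                        ≤⟨ level-down-column t ta≤ns y ⟩
    level 0 y + n                    ≡⟨ +-comm (level 0 y) n ⟩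
    n + level 0 y                    ∎)
    where
    open ≤-Reasoning
    column : Fin t → Colour
    column x = stair (toℕ x) y
    rise : ∀ x → column x ≡ colour2 → level (suc (toℕ x)) y ≡ suc (level (toℕ x) y)
    rise x = stair-colour2 (toℕ x) y
    stay : ∀ x → column x ≢ colour2 → level (suc (toℕ x)) y ≡ level (toℕ x) y
    stay x ≢2 = stair-colour1 (toℕ x) y (≢colour2⇒≡colour1 ≢2)

staircase-colouring : ∀ t s n a .{{_ : NonZero s}} → a + n ≡ s → t * a ≤ n * s →
  Σ (EdgeColouring t s) (λ col →
    ((x : Fin t) → degX col colour1 x ≡ n) ×
    ((y : Fin s) → degY col colour2 y ≤ n))
staircase-colouring t s n a a+n≡s ta≤ns =
    (λ x y → stair (toℕ x) (toℕ y))
  , (λ x → stair-row-count (toℕ x))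
  , (λ y → stair-column-count t ta≤ns (toℕ y))
  where open Staircase a n s a+n≡s

s∸[sn/t]≤n⇒t[s∸n]≤ns : ∀ t s n .{{_ : NonZero t}} → s ∸ (s * n) / t ≤ n → t * (s ∸ n) ≤ n * s
s∸[sn/t]≤n⇒t[s∸n]≤ns t s n s∸q≤n = begin
  t * (s ∸ n) ≤⟨ *-monoʳ-≤ t s∸n≤q ⟩
  t * q       ≡⟨ *-comm t q ⟩
  q * t       ≤⟨ m/n*n≤m (s * n) t ⟩
  s * n       ≡⟨ *-comm s n ⟩
  n * s       ∎
  where
  open ≤-Reasoning
  q = (s * n) / t
  s∸n≤q : s ∸ n ≤ q
  s∸n≤q = m≤n+o⇒m∸n≤o s n (≤-trans (m≤n+m∸n s q) (≤-trans (+-monoʳ-≤ q s∸q≤n) (≤-reflexive (+-comm q n))))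

lemma3p1 : (t s n : ℕ) → .{{_ : NonZero t}} → 2 ≤ n → n < s → s ≤ t →
    s ∸ ((s * n) / t) ≤ n →
    Σ (EdgeColouring t s) (λ col →
      ((x : Fin t) → degX col colour1 x ≤ n) ×
      ((y : Fin s) → degY col colour2 y ≤ n))
lemma3p1 t s n _ n<s _ s∸[sn/t]≤n =
  let col , row-degree , column-degree =
        staircase-colouring t s n (s ∸ n) {{>-nonZero (<-≤-trans z<s n<s)}}
          (m∸n+n≡m (<⇒≤ n<s)) (s∸[sn/t]≤n⇒t[s∸n]≤ns t s n s∸[sn/t]≤n)
  in col , (λ x → ≤-reflexive (row-degree x)) , column-degree
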